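{- Let $(T,\mu,\eta)$ be a monad and $F$ an endofunctor on a category $\mathcal C$, and let $\hat F$ be a Kleisli lifting of $F$ to $\mathrm{Kl}(T)$. Assume $F$ is algebraically complete, with initial algebra $\iota\colon FI\to I$, and that $\hat F$ is algebraically compact. Then the final $\hat F$-coalgebra is isomorphic to $K(\iota^{ -1})$, i.e. to the $\hat F$-coalgebra on $I$ given by the Kleisli arrow $\eta_{FI}\circ\iota^{ -1}\colon I\to TFI$.
   Context: $\mathrm{Kl}(T)$ is the Kleisli category of $T$ and $K\colon\mathcal C\to\mathrm{Kl}(T)$ the canonical functor (identity on objects, $f\mapsto\eta\circ f$). A Kleisli lifting of $F$ is an endofunctor $\hat F$ of $\mathrm{Kl}(T)$ with $\hat F\circ K=K\circ F$. An endofunctor is algebraically complete if it has an initial algebra, and algebraically compact if it has an initial algebra and a final coalgebra and they are canonically isomorphic (the final coalgebra is the inverse of the initial algebra). Since $\iota$ is an isomorphism, $\iota^{ -1}\colon I\to FI$ is an $F$-coalgebra and $K(\iota^{ -1})$ an $\hat F$-coalgebra. -}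

module Defs where

open import Level using (Level; _⊔_; suc)
open import Relation.Binary using (IsEquivalence; Setoid)
import Relation.Binary.Reasoning.Setoid as SetoidR

record Category (o ℓ e : Level) : Set (suc (o ⊔ ℓ ⊔ e)) where
  infixr 9 _∘_
  infix  4 _≈_
  field
    Obj       : Set o
    _⇒_       : Obj → Obj → Set ℓ
    _≈_       : ∀ {A B} → A ⇒ B → A ⇒ B → Set e
    id        : ∀ {A} → A ⇒ A
    _∘_       : ∀ {A B C} → B ⇒ C → A ⇒ B → A ⇒ C
    equiv     : ∀ {A B} → IsEquivalence (_≈_ {A} {B})
    assoc     : ∀ {A B C D} {f : A ⇒ B} {g : B ⇒ C} {h : C ⇒ D} →
                (h ∘ g) ∘ f ≈ h ∘ (g ∘ f)
    identityˡ : ∀ {A B} {f : A ⇒ B} → id ∘ f ≈ f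
    identityʳ : ∀ {A B} {f : A ⇒ B} → f ∘ id ≈ f
    ∘-resp-≈  : ∀ {A B C} {f h : B ⇒ C} {g i : A ⇒ B} →
                f ≈ h → g ≈ i → f ∘ g ≈ h ∘ i

  hom-setoid : Obj → Obj → Setoid ℓ e
  hom-setoid A B = record { Carrier = A ⇒ B ; _≈_ = _≈_ ; isEquivalence = equiv }

  module Equiv {A B : Obj} = IsEquivalence (equiv {A} {B})

record Functor {o ℓ e o′ ℓ′ e′ : Level}
               (C : Category o ℓ e) (D : Category o′ ℓ′ e′)
               : Set (o ⊔ ℓ ⊔ e ⊔ o′ ⊔ ℓ′ ⊔ e′) where
  private
    module C = Category C
    module D = Category D
  field
    F₀           : C.Obj → D.Obj
    F₁           : ∀ {A B} → A C.⇒ B → F₀ A D.⇒ F₀ B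
    identity     : ∀ {A} → F₁ (C.id {A}) D.≈ D.id
    homomorphism : ∀ {A B C′} {f : A C.⇒ B} {g : B C.⇒ C′} →
                   F₁ (g C.∘ f) D.≈ F₁ g D.∘ F₁ f
    F-resp-≈     : ∀ {A B} {f g : A C.⇒ B} → f C.≈ g → F₁ f D.≈ F₁ g

Endofunctor : ∀ {o ℓ e} → Category o ℓ e → Set (o ⊔ ℓ ⊔ e)
Endofunctor C = Functor C C

record Monad {o ℓ e} (C : Category o ℓ e) : Set (o ⊔ ℓ ⊔ e) where
  open Category C
  field
    T     : Endofunctor C
  open Functor T public renaming (F₀ to T₀; F₁ to T₁)
  field
    η      : ∀ A → A ⇒ T₀ A
    μ      : ∀ A → T₀ (T₀ A) ⇒ T₀ A
    η-nat  : ∀ {A B} (f : A ⇒ B) → T₁ f ∘ η A ≈ η B ∘ f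
    μ-nat  : ∀ {A B} (f : A ⇒ B) → T₁ f ∘ μ A ≈ μ B ∘ T₁ (T₁ f)
    μ-assoc : ∀ {A} → μ A ∘ T₁ (μ A) ≈ μ A ∘ μ (T₀ A)
    μ-idˡ  : ∀ {A} → μ A ∘ T₁ (η A) ≈ id
    μ-idʳ  : ∀ {A} → μ A ∘ η (T₀ A) ≈ id

module _ {o ℓ e} {C : Category o ℓ e} (M : Monad C) where
  open Category C
  open Monad M

  private
    infixr 9 _∘ₖ_
    _∘ₖ_ : ∀ {A B D} → B ⇒ T₀ D → A ⇒ T₀ B → A ⇒ T₀ D
    _∘ₖ_ {D = D} g f = μ D ∘ (T₁ g ∘ f)

    module R {A B} = SetoidR (hom-setoid A B)
    open Equiv

    reassoc4 : ∀ {A B X Y Z} {a : Y ⇒ Z} {b : X ⇒ Y} {c : B ⇒ X} {d : A ⇒ B} →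
               (a ∘ b) ∘ (c ∘ d) ≈ a ∘ (b ∘ (c ∘ d))
    reassoc4 = assoc

  Kl : Category o ℓ e
  Kl = record
    { Obj = Obj
    ; _⇒_ = λ A B → A ⇒ T₀ B
    ; _≈_ = _≈_
    ; id = λ {A} → η A
    ; _∘_ = _∘ₖ_
    ; equiv = equiv
    ; assoc = λ {A} {B} {C′} {D} {f} {g} {h} → kl-assoc {f = f} {g} {h}
    ; identityˡ = λ {A} {B} {f} →
        R.begin
          μ B ∘ (T₁ (η B) ∘ f)   R.≈⟨ sym assoc ⟩
          (μ B ∘ T₁ (η B)) ∘ f   R.≈⟨ ∘-resp-≈ μ-idˡ refl ⟩
          id ∘ f                 R.≈⟨ identityˡ ⟩
          f R.∎
    ; identityʳ = λ {A} {B} {f} →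
        R.begin
          μ B ∘ (T₁ f ∘ η A)     R.≈⟨ ∘-resp-≈ refl (η-nat f) ⟩
          μ B ∘ (η (T₀ B) ∘ f)   R.≈⟨ sym assoc ⟩
          (μ B ∘ η (T₀ B)) ∘ f   R.≈⟨ ∘-resp-≈ μ-idʳ refl ⟩
          id ∘ f                 R.≈⟨ identityˡ ⟩
          f R.∎
    ; ∘-resp-≈ = λ p q → ∘-resp-≈ refl (∘-resp-≈ (F-resp-≈ p) q)
    }
    where
    kl-assoc : ∀ {A B X D} {f : A ⇒ T₀ B} {g : B ⇒ T₀ X} {h : X ⇒ T₀ D} →
               (h ∘ₖ g) ∘ₖ f ≈ h ∘ₖ (g ∘ₖ f)
    kl-assoc {A} {B} {X} {D} {f} {g} {h} =
      R.begin
        μ D ∘ (T₁ (μ D ∘ (T₁ h ∘ g)) ∘ f)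
          R.≈⟨ ∘-resp-≈ refl (∘-resp-≈ (trans homomorphism (∘-resp-≈ refl homomorphism)) refl) ⟩
        μ D ∘ ((T₁ (μ D) ∘ (T₁ (T₁ h) ∘ T₁ g)) ∘ f)
          R.≈⟨ ∘-resp-≈ refl assoc ⟩
        μ D ∘ (T₁ (μ D) ∘ ((T₁ (T₁ h) ∘ T₁ g) ∘ f))
          R.≈⟨ sym assoc ⟩
        (μ D ∘ T₁ (μ D)) ∘ ((T₁ (T₁ h) ∘ T₁ g) ∘ f)
          R.≈⟨ ∘-resp-≈ μ-assoc refl ⟩
        (μ D ∘ μ (T₀ D)) ∘ ((T₁ (T₁ h) ∘ T₁ g) ∘ f)
          R.≈⟨ assoc ⟩
        μ D ∘ (μ (T₀ D) ∘ ((T₁ (T₁ h) ∘ T₁ g) ∘ f))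
          R.≈⟨ ∘-resp-≈ refl (∘-resp-≈ refl assoc) ⟩
        μ D ∘ (μ (T₀ D) ∘ (T₁ (T₁ h) ∘ (T₁ g ∘ f)))
          R.≈⟨ ∘-resp-≈ refl (sym assoc) ⟩
        μ D ∘ ((μ (T₀ D) ∘ T₁ (T₁ h)) ∘ (T₁ g ∘ f))
          R.≈⟨ ∘-resp-≈ refl (∘-resp-≈ (sym (μ-nat h)) refl) ⟩
        μ D ∘ ((T₁ h ∘ μ X) ∘ (T₁ g ∘ f))
          R.≈⟨ ∘-resp-≈ refl assoc ⟩
        μ D ∘ (T₁ h ∘ (μ X ∘ (T₁ g ∘ f)))
      R.∎

  -- canonical functor K : C → Kl(T) on morphisms: f ↦ η ∘ f
  -- (identity on objects)
  K₁ : ∀ {A B} → A ⇒ B → A ⇒ T₀ B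
  K₁ {A} {B} f = η B ∘ f

-- A Kleisli lifting F̂ of F is an endofunctor of Kl(T)
-- with F̂ ∘ K = K ∘ F.  Equality of functors on objects means F̂ acts as F₀
-- on objects; we build that in definitionally, and require
-- F̂₁ (K f) ≈ K (F₁ f) on morphisms.

record KleisliLifting {o ℓ e} {C : Category o ℓ e} (M : Monad C)
                      (F : Endofunctor C) : Set (o ⊔ ℓ ⊔ e) where
  private
    module C = Category C
    module KlC = Category (Kl M)
  open Monad M
  open Functor F
  field
    F̂₁           : ∀ {A B} → A KlC.⇒ B → F₀ A KlC.⇒ F₀ B
    identitŷ     : ∀ {A} → F̂₁ (KlC.id {A}) KlC.≈ KlC.id
    homomorphism̂ : ∀ {A B D} {f : A KlC.⇒ B} {g : B KlC.⇒ D} →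
                   F̂₁ (g KlC.∘ f) KlC.≈ F̂₁ g KlC.∘ F̂₁ f
    F̂-resp-≈     : ∀ {A B} {f g : A KlC.⇒ B} → f KlC.≈ g → F̂₁ f KlC.≈ F̂₁ g
    lifts        : ∀ {A B} (f : A C.⇒ B) → F̂₁ (K₁ M f) C.≈ K₁ M (F₁ f)

  F̂ : Endofunctor (Kl M)
  F̂ = record
    { F₀ = F₀ ; F₁ = F̂₁ ; identity = identitŷ
    ; homomorphism = homomorphism̂ ; F-resp-≈ = F̂-resp-≈ }

module _ {o ℓ e} {C : Category o ℓ e} (F : Endofunctor C) where
  open Category C
  open Functor F

  record IsInitialAlgebra (I : Obj) (ι : F₀ I ⇒ I) : Set (o ⊔ ℓ ⊔ e) where
    field
      ⦅_⦆      : ∀ {A} (a : F₀ A ⇒ A) → I ⇒ A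
      commute : ∀ {A} (a : F₀ A ⇒ A) → ⦅ a ⦆ ∘ ι ≈ a ∘ F₁ ⦅ a ⦆
      unique  : ∀ {A} (a : F₀ A ⇒ A) (h : I ⇒ A) →
                h ∘ ι ≈ a ∘ F₁ h → h ≈ ⦅ a ⦆

  record IsFinalCoalgebra (J : Obj) (c : J ⇒ F₀ J) : Set (o ⊔ ℓ ⊔ e) where
    field
      [_]     : ∀ {A} (a : A ⇒ F₀ A) → A ⇒ J
      commute : ∀ {A} (a : A ⇒ F₀ A) → c ∘ [ a ] ≈ F₁ [ a ] ∘ a
      unique  : ∀ {A} (a : A ⇒ F₀ A) (h : A ⇒ J) →
                c ∘ h ≈ F₁ h ∘ a → h ≈ [ a ]

  record AlgebraicallyComplete : Set (o ⊔ ℓ ⊔ e) where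
    field
      I       : Obj
      ι       : F₀ I ⇒ I
      initial : IsInitialAlgebra I ι

  record AlgebraicallyCompact : Set (o ⊔ ℓ ⊔ e) where
    field
      I       : Obj
      ι       : F₀ I ⇒ I
      initial : IsInitialAlgebra I ι
      ι⁻¹     : I ⇒ F₀ I
      isoˡ    : ι ∘ ι⁻¹ ≈ id
      isoʳ    : ι⁻¹ ∘ ι ≈ id
      final   : IsFinalCoalgebra I ι⁻¹

  record CoalgebraIso {A B : Obj} (a : A ⇒ F₀ A) (b : B ⇒ F₀ B)
                      : Set (ℓ ⊔ e) where
    field
      to       : A ⇒ B
      from     : B ⇒ A
      to-hom   : b ∘ to ≈ F₁ to ∘ a
      from-hom : a ∘ from ≈ F₁ from ∘ b
      isoˡ     : from ∘ to ≈ id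
      isoʳ     : to ∘ from ≈ id

{-# OPTIONS --safe #-}
module Submission where

-- The Kleisli image K ι of the initial F-algebra is an initial F̂-algebra: a
-- Kleisli arrow a : F A → T A, seen as an F̂-algebra, corresponds to the
-- F-algebra a ∘ₖ F̂(ε_A) on T A, where ε_A = id_{TA} is the counit of the
-- Kleisli adjunction, and since F̂ h = F̂(ε_A) ∘ₖ K(F h), a Kleisli arrow
-- h : I → T A is an F̂-algebra map out of K ι exactly when it is an F-algebra
-- map out of ι into that algebra.  Hence K ι and the initial F̂-algebra α are
-- isomorphic algebras, and an isomorphism between invertible algebras is an
-- isomorphism between the inverse coalgebras α⁻¹ and K(ι⁻¹).

open import Defs
import Relation.Binary.Reasoning.Setoid as SetoidR

module _ {o ℓ e} {D : Category o ℓ e} (F : Endofunctor D) where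
  open Category D
  open Equiv
  open Functor F
  private module R {A B} = SetoidR (hom-setoid A B)
  open R using (begin_; step-≈-⟩; step-≈-⟨; _∎)

  algebraHom-∘ : ∀ {A B X} {a : F₀ A ⇒ A} {b : F₀ B ⇒ B} {c : F₀ X ⇒ X}
                 {h : A ⇒ B} {g : B ⇒ X} →
                 g ∘ b ≈ c ∘ F₁ g → h ∘ a ≈ b ∘ F₁ h → (g ∘ h) ∘ a ≈ c ∘ F₁ (g ∘ h)
  algebraHom-∘ {a = a} {b} {c} {h} {g} gᵃ hᵃ = begin
    (g ∘ h) ∘ a        ≈⟨ assoc ⟩
    g ∘ (h ∘ a)        ≈⟨ ∘-resp-≈ refl hᵃ ⟩
    g ∘ (b ∘ F₁ h)     ≈⟨ assoc ⟨
    (g ∘ b) ∘ F₁ h     ≈⟨ ∘-resp-≈ gᵃ refl ⟩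
    (c ∘ F₁ g) ∘ F₁ h  ≈⟨ assoc ⟩
    c ∘ (F₁ g ∘ F₁ h)  ≈⟨ ∘-resp-≈ refl homomorphism ⟨
    c ∘ F₁ (g ∘ h)     ∎

  initial-endo≈id : ∀ {I ι} → IsInitialAlgebra F I ι →
                    {h : I ⇒ I} → h ∘ ι ≈ ι ∘ F₁ h → h ≈ id
  initial-endo≈id {ι = ι} init {h} hᵃ = trans (unique ι h hᵃ) (sym (unique ι id idᵃ))
    where
    open IsInitialAlgebra init
    idᵃ : id ∘ ι ≈ ι ∘ F₁ id
    idᵃ = trans identityˡ (sym (trans (∘-resp-≈ refl identity) identityʳ))

  ⦅⦆-inverse : ∀ {A B a b} (initA : IsInitialAlgebra F A a) (initB : IsInitialAlgebra F B b) →
               IsInitialAlgebra.⦅_⦆ initB a ∘ IsInitialAlgebra.⦅_⦆ initA b ≈ id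
  ⦅⦆-inverse {a = a} {b} initA initB =
    initial-endo≈id initA (algebraHom-∘ (IsInitialAlgebra.commute initB a)
                                        (IsInitialAlgebra.commute initA b))

  inverse-coalgebraHom : ∀ {A B} {a : F₀ A ⇒ A} {a⁻¹ : A ⇒ F₀ A} {b : F₀ B ⇒ B} {b⁻¹ : B ⇒ F₀ B}
                         {h : A ⇒ B} →
                         a ∘ a⁻¹ ≈ id → b⁻¹ ∘ b ≈ id →
                         h ∘ a ≈ b ∘ F₁ h → b⁻¹ ∘ h ≈ F₁ h ∘ a⁻¹
  inverse-coalgebraHom {a = a} {a⁻¹} {b} {b⁻¹} {h} aa⁻¹ b⁻¹b hᵃ = begin
    b⁻¹ ∘ h                      ≈⟨ ∘-resp-≈ refl (trans (∘-resp-≈ refl aa⁻¹) identityʳ) ⟨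
    b⁻¹ ∘ (h ∘ (a ∘ a⁻¹))        ≈⟨ ∘-resp-≈ refl assoc ⟨
    b⁻¹ ∘ ((h ∘ a) ∘ a⁻¹)        ≈⟨ ∘-resp-≈ refl (trans (∘-resp-≈ hᵃ refl) assoc) ⟩
    b⁻¹ ∘ (b ∘ (F₁ h ∘ a⁻¹))     ≈⟨ assoc ⟨
    (b⁻¹ ∘ b) ∘ (F₁ h ∘ a⁻¹)     ≈⟨ trans (∘-resp-≈ b⁻¹b refl) identityˡ ⟩
    F₁ h ∘ a⁻¹                   ∎

  initial-coalgebraIso : ∀ {A B a b} {a⁻¹ : A ⇒ F₀ A} {b⁻¹ : B ⇒ F₀ B} →
                         IsInitialAlgebra F A a → IsInitialAlgebra F B b →
                         a ∘ a⁻¹ ≈ id → a⁻¹ ∘ a ≈ id → b ∘ b⁻¹ ≈ id → b⁻¹ ∘ b ≈ id →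
                         CoalgebraIso F a⁻¹ b⁻¹
  initial-coalgebraIso {a = a} {b} initA initB aa⁻¹ a⁻¹a bb⁻¹ b⁻¹b = record
    { to       = IsInitialAlgebra.⦅_⦆ initA b
    ; from     = IsInitialAlgebra.⦅_⦆ initB a
    ; to-hom   = inverse-coalgebraHom aa⁻¹ b⁻¹b (IsInitialAlgebra.commute initA b)
    ; from-hom = inverse-coalgebraHom bb⁻¹ a⁻¹a (IsInitialAlgebra.commute initB a)
    ; isoˡ     = ⦅⦆-inverse initA initB
    ; isoʳ     = ⦅⦆-inverse initB initA
    }

module _ {o ℓ e} {C : Category o ℓ e} (M : Monad C) where
  open Category C
  open Equiv
  open Monad M
  open Category (Kl M) using () renaming (_∘_ to _∘ₖ_; id to idₖ)
  private module R {A B} = SetoidR (hom-setoid A B)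
  open R using (begin_; step-≈-⟩; step-≈-⟨; _∎)

  counit : ∀ {A} → Category._⇒_ (Kl M) (T₀ A) A
  counit = id

  ∘ₖ-K₁ : ∀ {A B X} (f : B ⇒ T₀ X) (g : A ⇒ B) → f ∘ₖ K₁ M g ≈ f ∘ g
  ∘ₖ-K₁ {B = B} {X} f g = begin
    μ X ∘ (T₁ f ∘ (η B ∘ g))     ≈⟨ ∘-resp-≈ refl (trans (sym assoc) (∘-resp-≈ (η-nat f) refl)) ⟩
    μ X ∘ ((η (T₀ X) ∘ f) ∘ g)   ≈⟨ trans (∘-resp-≈ refl assoc) (sym assoc) ⟩
    (μ X ∘ η (T₀ X)) ∘ (f ∘ g)   ≈⟨ trans (∘-resp-≈ μ-idʳ refl) identityˡ ⟩
    f ∘ g                        ∎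

  K₁-inverse : ∀ {A B} {f : A ⇒ B} {g : B ⇒ A} → f ∘ g ≈ id → K₁ M f ∘ₖ K₁ M g ≈ idₖ
  K₁-inverse {f = f} {g} fg = begin
    K₁ M f ∘ₖ K₁ M g   ≈⟨ ∘ₖ-K₁ (K₁ M f) g ⟩
    (η _ ∘ f) ∘ g      ≈⟨ assoc ⟩
    η _ ∘ (f ∘ g)      ≈⟨ trans (∘-resp-≈ refl fg) identityʳ ⟩
    idₖ                ∎

module _ {o ℓ e} {C : Category o ℓ e} {M : Monad C} {F : Endofunctor C}
         (L : KleisliLifting M F) where
  open Category C
  open Equiv
  open Monad M
  open Functor F
  open KleisliLifting L
  private module Kl = Category (Kl M)
  open Kl using () renaming (_∘_ to _∘ₖ_; id to idₖ)
  private module R {A B} = SetoidR (hom-setoid A B)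
  open R using (begin_; step-≈-⟩; step-≈-⟨; _∎)

  F-algebraOnT : ∀ {A} → F₀ A Kl.⇒ A → F₀ (T₀ A) ⇒ T₀ A
  F-algebraOnT a = a ∘ₖ F̂₁ (counit M)

  ∘ₖ-F̂₁ : ∀ {A X} (a : F₀ A Kl.⇒ A) (h : X Kl.⇒ A) → a ∘ₖ F̂₁ h ≈ F-algebraOnT a ∘ F₁ h
  ∘ₖ-F̂₁ a h = begin
    a ∘ₖ F̂₁ h                             ≈⟨ Kl.∘-resp-≈ refl (F̂-resp-≈ counit∘ₖK₁h) ⟨
    a ∘ₖ F̂₁ (counit M ∘ₖ K₁ M h)          ≈⟨ Kl.∘-resp-≈ refl homomorphism̂ ⟩
    a ∘ₖ (F̂₁ (counit M) ∘ₖ F̂₁ (K₁ M h))   ≈⟨ Kl.∘-resp-≈ refl (Kl.∘-resp-≈ refl (lifts h)) ⟩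
    a ∘ₖ (F̂₁ (counit M) ∘ₖ K₁ M (F₁ h))   ≈⟨ Kl.assoc ⟨
    F-algebraOnT a ∘ₖ K₁ M (F₁ h)         ≈⟨ ∘ₖ-K₁ M (F-algebraOnT a) (F₁ h) ⟩
    F-algebraOnT a ∘ F₁ h                 ∎
    where
    counit∘ₖK₁h : counit M ∘ₖ K₁ M h ≈ h
    counit∘ₖK₁h = trans (∘ₖ-K₁ M (counit M) h) identityˡ

  K₁-initial : ∀ {I ι} → IsInitialAlgebra F I ι → IsInitialAlgebra F̂ I (K₁ M ι)
  K₁-initial {ι = ι} init = record
    { ⦅_⦆     = λ a → ⦅ F-algebraOnT a ⦆
    ; commute = λ a → begin
        ⦅ F-algebraOnT a ⦆ ∘ₖ K₁ M ι                 ≈⟨ ∘ₖ-K₁ M ⦅ F-algebraOnT a ⦆ ι ⟩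
        ⦅ F-algebraOnT a ⦆ ∘ ι                       ≈⟨ commute (F-algebraOnT a) ⟩
        F-algebraOnT a ∘ F₁ ⦅ F-algebraOnT a ⦆       ≈⟨ ∘ₖ-F̂₁ a ⦅ F-algebraOnT a ⦆ ⟨
        a ∘ₖ F̂₁ ⦅ F-algebraOnT a ⦆                   ∎
    ; unique  = λ a h hᵃ → unique (F-algebraOnT a) h (begin
        h ∘ ι                  ≈⟨ ∘ₖ-K₁ M h ι ⟨
        h ∘ₖ K₁ M ι            ≈⟨ hᵃ ⟩
        a ∘ₖ F̂₁ h              ≈⟨ ∘ₖ-F̂₁ a h ⟩
        F-algebraOnT a ∘ F₁ h  ∎)
    }
    where open IsInitialAlgebra init

mainTheorem6 : ∀ {o ℓ e} {C : Category o ℓ e} (M : Monad C) (F : Endofunctor C)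
    (L : KleisliLifting M F) (Fc : AlgebraicallyComplete F)
    (ι⁻¹ : Category._⇒_ C (AlgebraicallyComplete.I Fc) (Functor.F₀ F (AlgebraicallyComplete.I Fc)))
    → Category._≈_ C (Category._∘_ C (AlgebraicallyComplete.ι Fc) ι⁻¹) (Category.id C)
    → Category._≈_ C (Category._∘_ C ι⁻¹ (AlgebraicallyComplete.ι Fc)) (Category.id C)
    → (F̂c : AlgebraicallyCompact (KleisliLifting.F̂ L))
    → CoalgebraIso (KleisliLifting.F̂ L) (AlgebraicallyCompact.ι⁻¹ F̂c) (K₁ M ι⁻¹)
mainTheorem6 M F L Fc ι⁻¹ ιι⁻¹ ι⁻¹ι F̂c =
  initial-coalgebraIso (KleisliLifting.F̂ L)
    initial (K₁-initial L (AlgebraicallyComplete.initial Fc))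
    isoˡ isoʳ (K₁-inverse M ιι⁻¹) (K₁-inverse M ι⁻¹ι)
  where open AlgebraicallyCompact F̂c using (initial; isoˡ; isoʳ)
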